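{- Let $X$ be a higher-order rewrite system, let $\mathcal{H}(X)$ be the free cartesian closed 2-category on $X$ and $\mathcal{R}(X)$ the rewriting 2-category of $X$ (both described in the context). There exists a cartesian closed 2-functor $\mathcal{H}(X)\to\mathcal{R}(X)$ which is the identity on objects, the identity on morphisms, and locally full (i.e., surjective on 2-cells between any two given parallel morphisms).
   Context: Types $\mathcal{L}_0(X_0)$ over a set $X_0$: $A,B::= x\mid 1\mid A\times B\mid B^A$. A 1-signature is a set $X_0$ of sorts and a set $X_1$ of operations each over a sequent $(A_1,\ldots,A_n\vdash A)$ of types. $\mathcal{L}_1(X)$: the 1-signature of simply-typed $\lambda$-terms (unit, products with pairing and projections $\pi,\pi'$, functions) over base types $X_0$ with term formers $c\langle M_1,\ldots,M_n\rangle$ for operations $c\in X_1$, modulo $\beta\eta$; $\mathcal{L}_1(X)_\parallel$ is the set of pairs of such terms over the same sequent. A 2-signature adds a set $X_2$ of rules with a map $a\colon X_2\to\mathcal{L}_1(X)_\parallel$; write $r\in X(G\vdash M,N\colon A)$ when $a(r)=(G\vdash M,N\colon A)$. A higher-order rewrite system is a 2-signature such that for every rule with $a(r)=(\Gamma\vdash M,N\colon A)$, $M$ is not a variable, $A$ is a sort, and every variable of $\Gamma$ occurs free in $M$. Reductions: judgements $\Gamma\vdash P\colon M\to N\colon A$ ($M,N$ terms modulo $\beta\eta$) generated by: rule application $r\langle P_1,\ldots,P_n\rangle\colon M[M_1,\ldots,M_n]\to N[N_1,\ldots,N_n]$ for $r\in X(G\vdash M,N\colon A)$ and $P_i\colon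 M_i\to N_i\colon G_i$; vertical composition $P;_{M_2}Q\colon M_1\to M_3$ for $P\colon M_1\to M_2$, $Q\colon M_2\to M_3$; and the term constructors lifted to reductions: variables $x\colon x\to x$, $()\colon()\to()$, $c\langle P_1,\ldots,P_n\rangle$, $\lambda x{:}A.P$, application $PQ\colon MN\to M'N'$, pairing $(P,Q)$, projections $\pi P,\pi' P$. Every term $M$ thus gives a reduction $M\colon M\to M$. For a tuple $\Gamma\vdash Q\colon N\to N'\colon\Delta$ and $\Delta\vdash P\colon M\to M'\colon A$, substitution is $P[Q]=P[N];_{M'[N]}M'[Q]$, where $M'[Q]$ replaces each variable $x_i$ by $Q_i$ in the term $M'$ and $P[N]$ substitutes the terms $N_i$ for the variables in $P$ (both structurally through all constructors). Permutation equivalence $\equiv$ is the least congruence (w.r.t. all reduction constructors) on reductions of equal type containing: associativity of $;$ and $M;P\equiv P\equiv P;N$ for $P\colon M\to N$; $(\lambda x.P)Q\equiv P[Q/x]$, $P\equiv\lambda x.(Px)$ ($x$ fresh), $\pi(P,Q)\equiv P$, $\pi'(P,Q)\equiv Q$, $P\equiv(\pi P,\pi'P)$, $P\equiv()$ at type $1$; for $r\in X(\Gamma\vdash M_1,M_2\colon A)$ and tuples $P\colon N_1\to N_2$, $Q\colon N_2\to N_3$: $r\langle P;Q\rangle\equiv M_1[P];r\langle Q\rangle$ and $r\langle P;Q\rangle\equiv r\langle P\rangle;M_2[Q]$; and each of $c\langle-\rangle$, $\lambda x$, application, pairing, $\pi$, $\pi'$ commutes with $;$ componentwise (e.g. $(P;P')(Q;Q')\equiv(PQ);(P'Q')$).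 $\mathcal{H}(X)$ is the cartesian closed 2-category with objects the types in $\mathcal{L}_0(X_0)$, morphisms $A\to B$ the terms $x\colon A\vdash M\colon B$ modulo $\beta\eta$ (composition by substitution, identities variables), 2-cells $M\Rightarrow N$ the $\equiv$-classes of reductions $x\colon A\vdash P\colon M\to N\colon B$ (vertical composition $;$, horizontal composition by substitution of reductions), with products, terminal object and exponentials given by the type formers. $\mathcal{R}(X)$ has the same objects and morphisms and exactly one 2-cell $M\Rightarrow N$ when $M\to^*N$ in the usual (Nipkow) sense, i.e. in the reflexive-transitive closure of the relation $L[\vec M/\vec x]\to R[\vec M/\vec x]$ for rules with $a(r)=(\vec x\colon G\vdash L,R\colon A)$, closed under all term constructors, and none otherwise. A cartesian closed 2-functor is a 2-functor strictly preserving the chosen terminal object, products, projections, exponentials and evaluation morphisms. -}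

module Defs where

open import Data.List using (List; []; _∷_)
open import Data.Product using (Σ; _×_; _,_; proj₁)
open import Data.Unit using (⊤)
open import Relation.Nullary using (¬_)
open import Relation.Binary.PropositionalEquality using (_≡_)

data Ty (S : Set) : Set where
  base : S → Ty S
  𝟙    : Ty S
  _⊗_  : Ty S → Ty S → Ty S
  _⇒_  : Ty S → Ty S → Ty S

Ctx : Set → Set
Ctx S = List (Ty S)

record Sig1 : Set₁ where
  field
    Sort : Set
    Op   : Set
    dom  : Op → Ctx Sort
    cod  : Op → Ty Sort

module Terms (Σ₁ : Sig1) where
  open Sig1 Σ₁ public

  T : Set
  T = Ty Sort

  C : Set
  C = Ctx Sort

  private variable
    A B : T
    Γ Δ Θ : C

  data Var : C → T → Set where
    vz : Var (A ∷ Γ) A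
    vs : Var Γ A → Var (B ∷ Γ) A

  mutual
    data Tm (Γ : C) : T → Set where
      var  : Var Γ A → Tm Γ A
      unit : Tm Γ 𝟙
      op   : (c : Op) → Tms Γ (dom c) → Tm Γ (cod c)
      lam  : Tm (A ∷ Γ) B → Tm Γ (A ⇒ B)
      app  : Tm Γ (A ⇒ B) → Tm Γ A → Tm Γ B
      pair : Tm Γ A → Tm Γ B → Tm Γ (A ⊗ B)
      fst  : Tm Γ (A ⊗ B) → Tm Γ A
      snd  : Tm Γ (A ⊗ B) → Tm Γ B

    data Tms (Γ : C) : C → Set where
      []  : Tms Γ []
      _∷_ : Tm Γ A → Tms Γ Δ → Tms Γ (A ∷ Δ)

  Ren : C → C → Set
  Ren Γ Δ = ∀ {A} → Var Δ A → Var Γ A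

  liftRen : Ren Γ Δ → Ren (A ∷ Γ) (A ∷ Δ)
  liftRen ρ vz     = vz
  liftRen ρ (vs x) = vs (ρ x)

  mutual
    ren : Ren Γ Δ → Tm Δ A → Tm Γ A
    ren ρ (var x)    = var (ρ x)
    ren ρ unit       = unit
    ren ρ (op c Ms)  = op c (rens ρ Ms)
    ren ρ (lam M)    = lam (ren (liftRen ρ) M)
    ren ρ (app M N)  = app (ren ρ M) (ren ρ N)
    ren ρ (pair M N) = pair (ren ρ M) (ren ρ N)
    ren ρ (fst M)    = fst (ren ρ M)
    ren ρ (snd M)    = snd (ren ρ M)

    rens : Ren Γ Δ → Tms Δ Θ → Tms Γ Θ
    rens ρ []       = []
    rens ρ (M ∷ Ms) = ren ρ M ∷ rens ρ Ms

  wk : Tm Γ A → Tm (B ∷ Γ) A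
  wk = ren vs

  Sub : C → C → Set
  Sub Γ Δ = ∀ {A} → Var Δ A → Tm Γ A

  liftSub : Sub Γ Δ → Sub (A ∷ Γ) (A ∷ Δ)
  liftSub σ vz     = var vz
  liftSub σ (vs x) = wk (σ x)

  mutual
    subst : Sub Γ Δ → Tm Δ A → Tm Γ A
    subst σ (var x)    = σ x
    subst σ unit       = unit
    subst σ (op c Ms)  = op c (substs σ Ms)
    subst σ (lam M)    = lam (subst (liftSub σ) M)
    subst σ (app M N)  = app (subst σ M) (subst σ N)
    subst σ (pair M N) = pair (subst σ M) (subst σ N)
    subst σ (fst M)    = fst (subst σ M)
    subst σ (snd M)    = snd (subst σ M)

    substs : Sub Γ Δ → Tms Δ Θ → Tms Γ Θ
    substs σ []       = []
    substs σ (M ∷ Ms) = subst σ M ∷ substs σ Ms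

  lookup : Tms Γ Δ → Sub Γ Δ
  lookup (M ∷ Ms) vz     = M
  lookup (M ∷ Ms) (vs x) = lookup Ms x

  _[_] : Tm Δ A → Tms Γ Δ → Tm Γ A
  M [ Ms ] = subst (lookup Ms) M

  _[_/0] : Tm (A ∷ Γ) B → Tm Γ A → Tm Γ B
  M [ N /0] = subst σ M
    where
      σ : Sub _ (_ ∷ _)
      σ vz     = N
      σ (vs x) = var x

  -- βη-conversion (terms are taken modulo this relation)
  mutual
    infix 4 _≈_ _≈s_
    data _≈_ {Γ : C} : {A : T} → Tm Γ A → Tm Γ A → Set where
      ≈refl  : {M : Tm Γ A} → M ≈ M
      ≈sym   : {M N : Tm Γ A} → M ≈ N → N ≈ M
      ≈trans : {M N K : Tm Γ A} → M ≈ N → N ≈ K → M ≈ K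
      ≈op    : (c : Op) {Ms Ns : Tms Γ (dom c)} → Ms ≈s Ns → op c Ms ≈ op c Ns
      ≈lam   : {M N : Tm (A ∷ Γ) B} → M ≈ N → lam M ≈ lam N
      ≈app   : {M M' : Tm Γ (A ⇒ B)} {N N' : Tm Γ A} →
               M ≈ M' → N ≈ N' → app M N ≈ app M' N'
      ≈pair  : {M M' : Tm Γ A} {N N' : Tm Γ B} →
               M ≈ M' → N ≈ N' → pair M N ≈ pair M' N'
      ≈fst   : {M N : Tm Γ (A ⊗ B)} → M ≈ N → fst M ≈ fst N
      ≈snd   : {M N : Tm Γ (A ⊗ B)} → M ≈ N → snd M ≈ snd N
      β      : (M : Tm (A ∷ Γ) B) (N : Tm Γ A) → app (lam M) N ≈ M [ N /0]
      η      : (M : Tm Γ (A ⇒ B)) → M ≈ lam (app (wk M) (var vz))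
      β₁     : (M : Tm Γ A) (N : Tm Γ B) → fst (pair M N) ≈ M
      β₂     : (M : Tm Γ A) (N : Tm Γ B) → snd (pair M N) ≈ N
      η⊗     : (M : Tm Γ (A ⊗ B)) → M ≈ pair (fst M) (snd M)
      η𝟙     : (M : Tm Γ 𝟙) → M ≈ unit

    data _≈s_ {Γ : C} : {Δ : C} → Tms Γ Δ → Tms Γ Δ → Set where
      []  : [] ≈s []
      _∷_ : {M N : Tm Γ A} {Ms Ns : Tms Γ Δ} →
            M ≈ N → Ms ≈s Ns → (M ∷ Ms) ≈s (N ∷ Ns)

  _─_ : (Γ : C) → Var Γ A → C
  (A ∷ Γ) ─ vz   = Γ
  (B ∷ Γ) ─ vs x = B ∷ (Γ ─ x)

  punch : (x : Var Γ A) → Ren Γ (Γ ─ x)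
  punch vz     y      = vs y
  punch (vs x) vz     = vz
  punch (vs x) (vs y) = vs (punch x y)

  -- x occurs free in the βη-class of M: M is not βη-equal to a term
  -- not mentioning x (i.e. x occurs in the βη-normal form of M)
  OccursFree : Var Γ A → Tm Γ B → Set
  OccursFree {Γ} {B = B} x M = ¬ (Σ (Tm (Γ ─ x) B) λ M' → M ≈ ren (punch x) M')

  IsVariable : Tm Γ A → Set
  IsVariable {Γ} {A} M = Σ (Var Γ A) λ x → M ≈ var x

record Sig2 : Set₁ where
  field
    sig1 : Sig1
  open Terms sig1
  field
    Rule : Set
    rctx : Rule → C
    rty  : Rule → T
    lhs  : (r : Rule) → Tm (rctx r) (rty r)
    rhs  : (r : Rule) → Tm (rctx r) (rty r)

record IsHRS (X : Sig2) : Set where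
  open Sig2 X
  open Terms sig1
  field
    lhs-not-var : (r : Rule) → ¬ IsVariable (lhs r)
    rty-sort    : (r : Rule) → Σ Sort λ s → rty r ≡ base s
    vars-occur  : (r : Rule) {A : T} (x : Var (rctx r) A) → OccursFree x (lhs r)

module Reductions (X : Sig2) where
  open Sig2 X public
  open Terms sig1 public

  private variable
    A B : T
    Γ Δ Θ : C

  mutual
    data Rd (Γ : C) : T → Set where
      var  : Var Γ A → Rd Γ A
      unit : Rd Γ 𝟙
      op   : (c : Op) → Rds Γ (dom c) → Rd Γ (cod c)
      lam  : Rd (A ∷ Γ) B → Rd Γ (A ⇒ B)
      app  : Rd Γ (A ⇒ B) → Rd Γ A → Rd Γ B
      pair : Rd Γ A → Rd Γ B → Rd Γ (A ⊗ B)
      fst  : Rd Γ (A ⊗ B) → Rd Γ A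
      snd  : Rd Γ (A ⊗ B) → Rd Γ B
      rule : (r : Rule) → Rds Γ (rctx r) → Rd Γ (rty r)
      seq  : Rd Γ A → Tm Γ A → Rd Γ A → Rd Γ A

    data Rds (Γ : C) : C → Set where
      []  : Rds Γ []
      _∷_ : Rd Γ A → Rds Γ Δ → Rds Γ (A ∷ Δ)

  seqs : Rds Γ Δ → Tms Γ Δ → Rds Γ Δ → Rds Γ Δ
  seqs []       []       []       = []
  seqs (P ∷ Ps) (M ∷ Ms) (Q ∷ Qs) = seq P M Q ∷ seqs Ps Ms Qs

  mutual
    ⌜_⌝ : Tm Γ A → Rd Γ A
    ⌜ var x ⌝    = var x
    ⌜ unit ⌝     = unit
    ⌜ op c Ms ⌝  = op c ⌜ Ms ⌝s
    ⌜ lam M ⌝    = lam ⌜ M ⌝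
    ⌜ app M N ⌝  = app ⌜ M ⌝ ⌜ N ⌝
    ⌜ pair M N ⌝ = pair ⌜ M ⌝ ⌜ N ⌝
    ⌜ fst M ⌝    = fst ⌜ M ⌝
    ⌜ snd M ⌝    = snd ⌜ M ⌝

    ⌜_⌝s : Tms Γ Δ → Rds Γ Δ
    ⌜ [] ⌝s     = []
    ⌜ M ∷ Ms ⌝s = ⌜ M ⌝ ∷ ⌜ Ms ⌝s

  mutual
    renR : Ren Γ Δ → Rd Δ A → Rd Γ A
    renR ρ (var x)     = var (ρ x)
    renR ρ unit        = unit
    renR ρ (op c Ps)   = op c (renRs ρ Ps)
    renR ρ (lam P)     = lam (renR (liftRen ρ) P)
    renR ρ (app P Q)   = app (renR ρ P) (renR ρ Q)
    renR ρ (pair P Q)  = pair (renR ρ P) (renR ρ Q)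
    renR ρ (fst P)     = fst (renR ρ P)
    renR ρ (snd P)     = snd (renR ρ P)
    renR ρ (rule r Ps) = rule r (renRs ρ Ps)
    renR ρ (seq P M Q) = seq (renR ρ P) (ren ρ M) (renR ρ Q)

    renRs : Ren Γ Δ → Rds Δ Θ → Rds Γ Θ
    renRs ρ []       = []
    renRs ρ (P ∷ Ps) = renR ρ P ∷ renRs ρ Ps

  mutual
    substRT : Sub Γ Δ → Rd Δ A → Rd Γ A
    substRT σ (var x)     = ⌜ σ x ⌝
    substRT σ unit        = unit
    substRT σ (op c Ps)   = op c (substRTs σ Ps)
    substRT σ (lam P)     = lam (substRT (liftSub σ) P)
    substRT σ (app P Q)   = app (substRT σ P) (substRT σ Q)
    substRT σ (pair P Q)  = pair (substRT σ P) (substRT σ Q)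
    substRT σ (fst P)     = fst (substRT σ P)
    substRT σ (snd P)     = snd (substRT σ P)
    substRT σ (rule r Ps) = rule r (substRTs σ Ps)
    substRT σ (seq P M Q) = seq (substRT σ P) (subst σ M) (substRT σ Q)

    substRTs : Sub Γ Δ → Rds Δ Θ → Rds Γ Θ
    substRTs σ []       = []
    substRTs σ (P ∷ Ps) = substRT σ P ∷ substRTs σ Ps

  RSub : C → C → Set
  RSub Γ Δ = ∀ {A} → Var Δ A → Rd Γ A

  liftRSub : RSub Γ Δ → RSub (A ∷ Γ) (A ∷ Δ)
  liftRSub τ vz     = var vz
  liftRSub τ (vs x) = renR vs (τ x)

  mutual
    substTR : RSub Γ Δ → Tm Δ A → Rd Γ A
    substTR τ (var x)    = τ x
    substTR τ unit       = unit
    substTR τ (op c Ms)  = op c (substTRs τ Ms)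
    substTR τ (lam M)    = lam (substTR (liftRSub τ) M)
    substTR τ (app M N)  = app (substTR τ M) (substTR τ N)
    substTR τ (pair M N) = pair (substTR τ M) (substTR τ N)
    substTR τ (fst M)    = fst (substTR τ M)
    substTR τ (snd M)    = snd (substTR τ M)

    substTRs : RSub Γ Δ → Tms Δ Θ → Rds Γ Θ
    substTRs τ []       = []
    substTRs τ (M ∷ Ms) = substTR τ M ∷ substTRs τ Ms

  lookupR : Rds Γ Δ → RSub Γ Δ
  lookupR (P ∷ Ps) vz     = P
  lookupR (P ∷ Ps) (vs x) = lookupR Ps x

  sub0 : Tm Γ A → Sub Γ (A ∷ Γ)
  sub0 N vz     = N
  sub0 N (vs x) = var x

  rsub0 : Rd Γ A → RSub Γ (A ∷ Γ)
  rsub0 Q vz     = Q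
  rsub0 Q (vs x) = var x

  mutual
    infix 3 _∶_⟶_ _∶s_⟶_
    data _∶_⟶_ {Γ : C} : {A : T} → Rd Γ A → Tm Γ A → Tm Γ A → Set where
      t-var  : (x : Var Γ A) → var x ∶ var x ⟶ var x
      t-unit : unit ∶ unit ⟶ unit
      t-op   : (c : Op) {Ps : Rds Γ (dom c)} {Ms Ns : Tms Γ (dom c)} →
               Ps ∶s Ms ⟶ Ns → op c Ps ∶ op c Ms ⟶ op c Ns
      t-lam  : {P : Rd (A ∷ Γ) B} {M N : Tm (A ∷ Γ) B} →
               P ∶ M ⟶ N → lam P ∶ lam M ⟶ lam N
      t-app  : {P : Rd Γ (A ⇒ B)} {Q : Rd Γ A} {M M' : Tm Γ (A ⇒ B)} {N N' : Tm Γ A} →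
               P ∶ M ⟶ M' → Q ∶ N ⟶ N' → app P Q ∶ app M N ⟶ app M' N'
      t-pair : {P : Rd Γ A} {Q : Rd Γ B} {M M' : Tm Γ A} {N N' : Tm Γ B} →
               P ∶ M ⟶ M' → Q ∶ N ⟶ N' → pair P Q ∶ pair M N ⟶ pair M' N'
      t-fst  : {P : Rd Γ (A ⊗ B)} {M N : Tm Γ (A ⊗ B)} →
               P ∶ M ⟶ N → fst P ∶ fst M ⟶ fst N
      t-snd  : {P : Rd Γ (A ⊗ B)} {M N : Tm Γ (A ⊗ B)} →
               P ∶ M ⟶ N → snd P ∶ snd M ⟶ snd N
      t-rule : (r : Rule) {Ps : Rds Γ (rctx r)} {Ms Ns : Tms Γ (rctx r)} →
               Ps ∶s Ms ⟶ Ns → rule r Ps ∶ lhs r [ Ms ] ⟶ rhs r [ Ns ]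
      t-seq  : {P Q : Rd Γ A} {M₁ M₂ M₃ : Tm Γ A} →
               P ∶ M₁ ⟶ M₂ → Q ∶ M₂ ⟶ M₃ → seq P M₂ Q ∶ M₁ ⟶ M₃
      t-conv : {P : Rd Γ A} {M M' N N' : Tm Γ A} →
               P ∶ M ⟶ N → M ≈ M' → N ≈ N' → P ∶ M' ⟶ N'

    data _∶s_⟶_ {Γ : C} : {Δ : C} → Rds Γ Δ → Tms Γ Δ → Tms Γ Δ → Set where
      []  : [] ∶s [] ⟶ []
      _∷_ : {P : Rd Γ A} {M N : Tm Γ A} {Ps : Rds Γ Δ} {Ms Ns : Tms Γ Δ} →
            P ∶ M ⟶ N → Ps ∶s Ms ⟶ Ns → (P ∷ Ps) ∶s (M ∷ Ms) ⟶ (N ∷ Ns)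

  mutual
    infix 3 _≡ₚ_∶_⟶_ _≡ₚs_∶_⟶_
    data _≡ₚ_∶_⟶_ {Γ : C} : {A : T} → Rd Γ A → Rd Γ A → Tm Γ A → Tm Γ A → Set where
      e-refl  : {P : Rd Γ A} {M N : Tm Γ A} → P ∶ M ⟶ N → P ≡ₚ P ∶ M ⟶ N
      e-sym   : {P P' : Rd Γ A} {M N : Tm Γ A} → P ≡ₚ P' ∶ M ⟶ N → P' ≡ₚ P ∶ M ⟶ N
      e-trans : {P P' P'' : Rd Γ A} {M N : Tm Γ A} →
                P ≡ₚ P' ∶ M ⟶ N → P' ≡ₚ P'' ∶ M ⟶ N → P ≡ₚ P'' ∶ M ⟶ N
      e-conv  : {P P' : Rd Γ A} {M M' N N' : Tm Γ A} →
                P ≡ₚ P' ∶ M ⟶ N → M ≈ M' → N ≈ N' → P ≡ₚ P' ∶ M' ⟶ N'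
      e-mid   : {P Q : Rd Γ A} {M₁ M₂ M₂' M₃ : Tm Γ A} →
                P ∶ M₁ ⟶ M₂ → Q ∶ M₂ ⟶ M₃ → M₂ ≈ M₂' →
                seq P M₂ Q ≡ₚ seq P M₂' Q ∶ M₁ ⟶ M₃
      c-op    : (c : Op) {Ps Ps' : Rds Γ (dom c)} {Ms Ns : Tms Γ (dom c)} →
                Ps ≡ₚs Ps' ∶ Ms ⟶ Ns → op c Ps ≡ₚ op c Ps' ∶ op c Ms ⟶ op c Ns
      c-lam   : {P P' : Rd (A ∷ Γ) B} {M N : Tm (A ∷ Γ) B} →
                P ≡ₚ P' ∶ M ⟶ N → lam P ≡ₚ lam P' ∶ lam M ⟶ lam N
      c-app   : {P P' : Rd Γ (A ⇒ B)} {Q Q' : Rd Γ A} {M M' : Tm Γ (A ⇒ B)} {N N' : Tm Γ A} →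
                P ≡ₚ P' ∶ M ⟶ M' → Q ≡ₚ Q' ∶ N ⟶ N' → app P Q ≡ₚ app P' Q' ∶ app M N ⟶ app M' N'
      c-pair  : {P P' : Rd Γ A} {Q Q' : Rd Γ B} {M M' : Tm Γ A} {N N' : Tm Γ B} →
                P ≡ₚ P' ∶ M ⟶ M' → Q ≡ₚ Q' ∶ N ⟶ N' → pair P Q ≡ₚ pair P' Q' ∶ pair M N ⟶ pair M' N'
      c-fst   : {P P' : Rd Γ (A ⊗ B)} {M N : Tm Γ (A ⊗ B)} →
                P ≡ₚ P' ∶ M ⟶ N → fst P ≡ₚ fst P' ∶ fst M ⟶ fst N
      c-snd   : {P P' : Rd Γ (A ⊗ B)} {M N : Tm Γ (A ⊗ B)} →
                P ≡ₚ P' ∶ M ⟶ N → snd P ≡ₚ snd P' ∶ snd M ⟶ snd N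
      c-rule  : (r : Rule) {Ps Ps' : Rds Γ (rctx r)} {Ms Ns : Tms Γ (rctx r)} →
                Ps ≡ₚs Ps' ∶ Ms ⟶ Ns → rule r Ps ≡ₚ rule r Ps' ∶ lhs r [ Ms ] ⟶ rhs r [ Ns ]
      c-seq   : {P P' Q Q' : Rd Γ A} {M₁ M₂ M₃ : Tm Γ A} →
                P ≡ₚ P' ∶ M₁ ⟶ M₂ → Q ≡ₚ Q' ∶ M₂ ⟶ M₃ → seq P M₂ Q ≡ₚ seq P' M₂ Q' ∶ M₁ ⟶ M₃
      assoc   : {P Q R : Rd Γ A} {M₁ M₂ M₃ M₄ : Tm Γ A} →
                P ∶ M₁ ⟶ M₂ → Q ∶ M₂ ⟶ M₃ → R ∶ M₃ ⟶ M₄ →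
                seq (seq P M₂ Q) M₃ R ≡ₚ seq P M₂ (seq Q M₃ R) ∶ M₁ ⟶ M₄
      idˡ     : {P : Rd Γ A} {M N : Tm Γ A} → P ∶ M ⟶ N → seq ⌜ M ⌝ M P ≡ₚ P ∶ M ⟶ N
      idʳ     : {P : Rd Γ A} {M N : Tm Γ A} → P ∶ M ⟶ N → seq P N ⌜ N ⌝ ≡ₚ P ∶ M ⟶ N
      -- β/η laws ((λx.P)Q ≡ P[Q/x] with P[Q/x] = P[N/x] ;_{M'[N/x]} M'[Q/x])
      e-β     : {P : Rd (A ∷ Γ) B} {Q : Rd Γ A} {M M' : Tm (A ∷ Γ) B} {N N' : Tm Γ A} →
                P ∶ M ⟶ M' → Q ∶ N ⟶ N' →
                app (lam P) Q ≡ₚ seq (substRT (sub0 N) P) (subst (sub0 N) M') (substTR (rsub0 Q) M')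
                  ∶ app (lam M) N ⟶ app (lam M') N'
      e-η     : {P : Rd Γ (A ⇒ B)} {M N : Tm Γ (A ⇒ B)} →
                P ∶ M ⟶ N → P ≡ₚ lam (app (renR vs P) (var vz)) ∶ M ⟶ N
      e-β₁    : {P : Rd Γ A} {Q : Rd Γ B} {M M' : Tm Γ A} {N N' : Tm Γ B} →
                P ∶ M ⟶ M' → Q ∶ N ⟶ N' → fst (pair P Q) ≡ₚ P ∶ M ⟶ M'
      e-β₂    : {P : Rd Γ A} {Q : Rd Γ B} {M M' : Tm Γ A} {N N' : Tm Γ B} →
                P ∶ M ⟶ M' → Q ∶ N ⟶ N' → snd (pair P Q) ≡ₚ Q ∶ N ⟶ N'
      e-η⊗    : {P : Rd Γ (A ⊗ B)} {M N : Tm Γ (A ⊗ B)} →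
                P ∶ M ⟶ N → P ≡ₚ pair (fst P) (snd P) ∶ M ⟶ N
      e-η𝟙    : {P : Rd Γ 𝟙} {M N : Tm Γ 𝟙} → P ∶ M ⟶ N → P ≡ₚ unit ∶ M ⟶ N
      rule-l  : (r : Rule) {Ps Qs : Rds Γ (rctx r)} {N₁ N₂ N₃ : Tms Γ (rctx r)} →
                Ps ∶s N₁ ⟶ N₂ → Qs ∶s N₂ ⟶ N₃ →
                rule r (seqs Ps N₂ Qs) ≡ₚ seq (substTR (lookupR Ps) (lhs r)) (lhs r [ N₂ ]) (rule r Qs)
                  ∶ lhs r [ N₁ ] ⟶ rhs r [ N₃ ]
      rule-r  : (r : Rule) {Ps Qs : Rds Γ (rctx r)} {N₁ N₂ N₃ : Tms Γ (rctx r)} →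
                Ps ∶s N₁ ⟶ N₂ → Qs ∶s N₂ ⟶ N₃ →
                rule r (seqs Ps N₂ Qs) ≡ₚ seq (rule r Ps) (rhs r [ N₂ ]) (substTR (lookupR Qs) (rhs r))
                  ∶ lhs r [ N₁ ] ⟶ rhs r [ N₃ ]
      op-seq  : (c : Op) {Ps Qs : Rds Γ (dom c)} {N₁ N₂ N₃ : Tms Γ (dom c)} →
                Ps ∶s N₁ ⟶ N₂ → Qs ∶s N₂ ⟶ N₃ →
                op c (seqs Ps N₂ Qs) ≡ₚ seq (op c Ps) (op c N₂) (op c Qs) ∶ op c N₁ ⟶ op c N₃
      lam-seq : {P Q : Rd (A ∷ Γ) B} {M₁ M₂ M₃ : Tm (A ∷ Γ) B} →
                P ∶ M₁ ⟶ M₂ → Q ∶ M₂ ⟶ M₃ →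
                lam (seq P M₂ Q) ≡ₚ seq (lam P) (lam M₂) (lam Q) ∶ lam M₁ ⟶ lam M₃
      app-seq : {P P' : Rd Γ (A ⇒ B)} {Q Q' : Rd Γ A}
                {M₁ M₂ M₃ : Tm Γ (A ⇒ B)} {N₁ N₂ N₃ : Tm Γ A} →
                P ∶ M₁ ⟶ M₂ → P' ∶ M₂ ⟶ M₃ → Q ∶ N₁ ⟶ N₂ → Q' ∶ N₂ ⟶ N₃ →
                app (seq P M₂ P') (seq Q N₂ Q') ≡ₚ seq (app P Q) (app M₂ N₂) (app P' Q')
                  ∶ app M₁ N₁ ⟶ app M₃ N₃
      pair-seq : {P P' : Rd Γ A} {Q Q' : Rd Γ B}
                 {M₁ M₂ M₃ : Tm Γ A} {N₁ N₂ N₃ : Tm Γ B} →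
                 P ∶ M₁ ⟶ M₂ → P' ∶ M₂ ⟶ M₃ → Q ∶ N₁ ⟶ N₂ → Q' ∶ N₂ ⟶ N₃ →
                 pair (seq P M₂ P') (seq Q N₂ Q') ≡ₚ seq (pair P Q) (pair M₂ N₂) (pair P' Q')
                   ∶ pair M₁ N₁ ⟶ pair M₃ N₃
      fst-seq : {P Q : Rd Γ (A ⊗ B)} {M₁ M₂ M₃ : Tm Γ (A ⊗ B)} →
                P ∶ M₁ ⟶ M₂ → Q ∶ M₂ ⟶ M₃ →
                fst (seq P M₂ Q) ≡ₚ seq (fst P) (fst M₂) (fst Q) ∶ fst M₁ ⟶ fst M₃
      snd-seq : {P Q : Rd Γ (A ⊗ B)} {M₁ M₂ M₃ : Tm Γ (A ⊗ B)} →
                P ∶ M₁ ⟶ M₂ → Q ∶ M₂ ⟶ M₃ →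
                snd (seq P M₂ Q) ≡ₚ seq (snd P) (snd M₂) (snd Q) ∶ snd M₁ ⟶ snd M₃

    data _≡ₚs_∶_⟶_ {Γ : C} : {Δ : C} → Rds Γ Δ → Rds Γ Δ → Tms Γ Δ → Tms Γ Δ → Set where
      []  : [] ≡ₚs [] ∶ [] ⟶ []
      _∷_ : {P P' : Rd Γ A} {M N : Tm Γ A} {Ps Ps' : Rds Γ Δ} {Ms Ns : Tms Γ Δ} →
            P ≡ₚ P' ∶ M ⟶ N → Ps ≡ₚs Ps' ∶ Ms ⟶ Ns → (P ∷ Ps) ≡ₚs (P' ∷ Ps') ∶ (M ∷ Ms) ⟶ (N ∷ Ns)

  mutual
    infix 3 _↦_ _↦s_ _⟶*_
    data _↦_ {Γ : C} : {A : T} → Tm Γ A → Tm Γ A → Set where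
      root  : (r : Rule) (Ms : Tms Γ (rctx r)) → lhs r [ Ms ] ↦ rhs r [ Ms ]
      s-op  : (c : Op) {Ms Ns : Tms Γ (dom c)} → Ms ↦s Ns → op c Ms ↦ op c Ns
      s-lam : {M N : Tm (A ∷ Γ) B} → M ↦ N → lam M ↦ lam N
      s-appˡ : {M M' : Tm Γ (A ⇒ B)} {N : Tm Γ A} → M ↦ M' → app M N ↦ app M' N
      s-appʳ : {M : Tm Γ (A ⇒ B)} {N N' : Tm Γ A} → N ↦ N' → app M N ↦ app M N'
      s-pairˡ : {M M' : Tm Γ A} {N : Tm Γ B} → M ↦ M' → pair M N ↦ pair M' N
      s-pairʳ : {M : Tm Γ A} {N N' : Tm Γ B} → N ↦ N' → pair M N ↦ pair M N'
      s-fst : {M N : Tm Γ (A ⊗ B)} → M ↦ N → fst M ↦ fst N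
      s-snd : {M N : Tm Γ (A ⊗ B)} → M ↦ N → snd M ↦ snd N

    data _↦s_ {Γ : C} : {Δ : C} → Tms Γ Δ → Tms Γ Δ → Set where
      here  : {M N : Tm Γ A} {Ms : Tms Γ Δ} → M ↦ N → (M ∷ Ms) ↦s (N ∷ Ms)
      there : {M : Tm Γ A} {Ms Ns : Tms Γ Δ} → Ms ↦s Ns → (M ∷ Ms) ↦s (M ∷ Ns)

  data _⟶*_ {Γ : C} {A : T} : Tm Γ A → Tm Γ A → Set where
    conv  : {M N : Tm Γ A} → M ≈ N → M ⟶* N
    step  : {M N : Tm Γ A} → M ↦ N → M ⟶* N
    trans : {M N K : Tm Γ A} → M ⟶* N → N ⟶* K → M ⟶* K

  -- Hom-categories of H(X) and R(X).  A morphism A → B (in both) is a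
  -- term  x : A ⊢ M : B  modulo βη.

  Mor : T → T → Set
  Mor A B = Tm (A ∷ []) B

  -- 2-cells M ⇒ N of H(X): reductions x:A ⊢ P : M → N : B modulo ≡
  Cell : {A B : T} → Mor A B → Mor A B → Set
  Cell M N = Σ (Rd _ _) λ P → P ∶ M ⟶ N

  _≈H_ : {A B : T} {M N : Mor A B} → Cell M N → Cell M N → Set
  _≈H_ {M = M} {N} c d = proj₁ c ≡ₚ proj₁ d ∶ M ⟶ N

  mutual
    ⌜⌝-typed : {Γ : C} {A : T} (M : Tm Γ A) → ⌜ M ⌝ ∶ M ⟶ M
    ⌜⌝-typed (var x)    = t-var x
    ⌜⌝-typed unit       = t-unit
    ⌜⌝-typed (op c Ms)  = t-op c (⌜⌝-typeds Ms)
    ⌜⌝-typed (lam M)    = t-lam (⌜⌝-typed M)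
    ⌜⌝-typed (app M N)  = t-app (⌜⌝-typed M) (⌜⌝-typed N)
    ⌜⌝-typed (pair M N) = t-pair (⌜⌝-typed M) (⌜⌝-typed N)
    ⌜⌝-typed (fst M)    = t-fst (⌜⌝-typed M)
    ⌜⌝-typed (snd M)    = t-snd (⌜⌝-typed M)

    ⌜⌝-typeds : {Γ Δ : C} (Ms : Tms Γ Δ) → ⌜ Ms ⌝s ∶s Ms ⟶ Ms
    ⌜⌝-typeds []       = []
    ⌜⌝-typeds (M ∷ Ms) = ⌜⌝-typed M ∷ ⌜⌝-typeds Ms

  idH : {A B : T} (M : Mor A B) → Cell M M
  idH M = ⌜ M ⌝ , ⌜⌝-typed M

  vcompH : {A B : T} {M N K : Mor A B} → Cell M N → Cell N K → Cell M K
  vcompH {N = N} (P , p) (Q , q) = seq P N Q , t-seq p q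

  -- 2-cells M ⇒ N of R(X): exactly one when M →* N, none otherwise.
  Cell₂R : {A B : T} → Mor A B → Mor A B → Set
  Cell₂R M N = M ⟶* N

  _≈R_ : {A B : T} {M N : Mor A B} → Cell₂R M N → Cell₂R M N → Set
  s ≈R t = ⊤

  idR : {A B : T} (M : Mor A B) → Cell₂R M M
  idR M = conv ≈refl

  vcompR : {A B : T} {M N K : Mor A B} → Cell₂R M N → Cell₂R N K → Cell₂R M K
  vcompR = trans

  -- A 2-functor H(X) → R(X) that is the identity on objects and on
  -- morphisms: given by its action on 2-cells, well defined on
  -- ≡-classes and preserving identities and vertical composition.
  -- (Preservation of horizontal composition and of the cartesian closed
  -- structure are equations between 2-cells of R(X), which is locally
  -- thin, and hold automatically; on objects and morphisms these
  -- preservation properties hold strictly since F is the identity and the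
  -- chosen cartesian closed structures of H(X) and R(X) coincide.)

  record IdTwoFunctor : Set where
    field
      F₂       : {A B : T} {M N : Mor A B} → Cell M N → Cell₂R M N
      F₂-resp  : {A B : T} {M N : Mor A B} {c d : Cell M N} → c ≈H d → F₂ c ≈R F₂ d
      F₂-id    : {A B : T} (M : Mor A B) → F₂ (idH M) ≈R idR M
      F₂-vcomp : {A B : T} {M N K : Mor A B} (c : Cell M N) (d : Cell N K) →
                 F₂ (vcompH c d) ≈R vcompR (F₂ c) (F₂ d)

  LocallyFull : IdTwoFunctor → Set
  LocallyFull F = {A B : T} {M N : Mor A B} (s : Cell₂R M N) →
                  Σ (Cell M N) λ c → IdTwoFunctor.F₂ F c ≈R s

module Submission where

-- The 2-functor H(X) → R(X) sends a reduction  P : M → N  to the fact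
-- M →* N, by induction on the typing derivation of P: term constructors
-- go to the corresponding congruence closures of →*, a rule application
-- r⟨P₁,…,Pₙ⟩ : L[M⃗] → R[N⃗] goes to the root step L[M⃗] → R[M⃗] followed by
-- R[M⃗] →* R[N⃗] (monotonicity of substitution), and vertical composition
-- goes to transitivity.  Since R(X) has at most one 2-cell between two
-- morphisms, compatibility with ≡, identities, vertical composition (and
-- the remaining 2-functor and cartesian closed structure) is automatic.
-- Local fullness is the converse translation: every one-step rewrite is
-- the image of a reduction built from a single rule application inside
-- identity reductions, and a rewrite sequence is a vertical composite.

open import Defs
open import Data.Product using (Σ; _,_; proj₂)
open import Data.Unit using (tt)
open import Data.List using ([]; _∷_)
open import Relation.Binary.PropositionalEquality
  using (_≡_; refl; sym; cong; cong₂; subst₂; module ≡-Reasoning)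
  renaming (trans to ≡-trans)

module FunctorToRewriting (X : Sig2) where
  open Reductions X

  private variable
    A B : T
    Γ Γ' Δ Θ Ξ : C

  ren-ren : {ρ : Ren Γ Δ} {ρ' : Ren Δ Θ} {ρ'' : Ren Γ Θ} →
            (∀ {A} (x : Var Θ A) → ρ (ρ' x) ≡ ρ'' x) →
            (M : Tm Θ A) → ren ρ (ren ρ' M) ≡ ren ρ'' M
  rens-ren : {ρ : Ren Γ Δ} {ρ' : Ren Δ Θ} {ρ'' : Ren Γ Θ} →
             (∀ {A} (x : Var Θ A) → ρ (ρ' x) ≡ ρ'' x) →
             (Ms : Tms Θ Ξ) → rens ρ (rens ρ' Ms) ≡ rens ρ'' Ms
  ren-ren h (var x)    = cong var (h x)
  ren-ren h unit       = refl
  ren-ren h (op c Ms)  = cong (op c) (rens-ren h Ms)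
  ren-ren {ρ = ρ} {ρ'} {ρ''} h (lam M) = cong lam (ren-ren lifted M)
    where
      lifted : ∀ {A} (x : Var (B ∷ _) A) → liftRen ρ (liftRen ρ' x) ≡ liftRen ρ'' x
      lifted vz     = refl
      lifted (vs x) = cong vs (h x)
  ren-ren h (app M N)  = cong₂ app (ren-ren h M) (ren-ren h N)
  ren-ren h (pair M N) = cong₂ pair (ren-ren h M) (ren-ren h N)
  ren-ren h (fst M)    = cong fst (ren-ren h M)
  ren-ren h (snd M)    = cong snd (ren-ren h M)
  rens-ren h []       = refl
  rens-ren h (M ∷ Ms) = cong₂ _∷_ (ren-ren h M) (rens-ren h Ms)

  wk-liftRen : (ρ : Ren Γ Δ) (M : Tm Δ A) → ren (liftRen {A = B} ρ) (wk M) ≡ wk (ren ρ M)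
  wk-liftRen ρ M = begin
    ren (liftRen ρ) (wk M)  ≡⟨ ren-ren (λ _ → refl) M ⟩
    ren (λ x → vs (ρ x)) M  ≡⟨ sym (ren-ren (λ _ → refl) M) ⟩
    wk (ren ρ M)            ∎
    where open ≡-Reasoning

  ren-sub : {ρ : Ren Γ Δ} {σ : Sub Δ Θ} {σ' : Sub Γ Θ} →
            (∀ {A} (x : Var Θ A) → ren ρ (σ x) ≡ σ' x) →
            (M : Tm Θ A) → ren ρ (subst σ M) ≡ subst σ' M
  rens-sub : {ρ : Ren Γ Δ} {σ : Sub Δ Θ} {σ' : Sub Γ Θ} →
             (∀ {A} (x : Var Θ A) → ren ρ (σ x) ≡ σ' x) →
             (Ms : Tms Θ Ξ) → rens ρ (substs σ Ms) ≡ substs σ' Ms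
  ren-sub h (var x)    = h x
  ren-sub h unit       = refl
  ren-sub h (op c Ms)  = cong (op c) (rens-sub h Ms)
  ren-sub {ρ = ρ} {σ} {σ'} h (lam M) = cong lam (ren-sub lifted M)
    where
      lifted : ∀ {A} (x : Var (B ∷ _) A) → ren (liftRen ρ) (liftSub σ x) ≡ liftSub σ' x
      lifted vz     = refl
      lifted (vs x) = ≡-trans (wk-liftRen ρ (σ x)) (cong wk (h x))
  ren-sub h (app M N)  = cong₂ app (ren-sub h M) (ren-sub h N)
  ren-sub h (pair M N) = cong₂ pair (ren-sub h M) (ren-sub h N)
  ren-sub h (fst M)    = cong fst (ren-sub h M)
  ren-sub h (snd M)    = cong snd (ren-sub h M)
  rens-sub h []       = refl
  rens-sub h (M ∷ Ms) = cong₂ _∷_ (ren-sub h M) (rens-sub h Ms)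

  sub-ren : {σ : Sub Γ Δ} {ρ : Ren Δ Θ} {σ' : Sub Γ Θ} →
            (∀ {A} (x : Var Θ A) → σ (ρ x) ≡ σ' x) →
            (M : Tm Θ A) → subst σ (ren ρ M) ≡ subst σ' M
  subs-ren : {σ : Sub Γ Δ} {ρ : Ren Δ Θ} {σ' : Sub Γ Θ} →
             (∀ {A} (x : Var Θ A) → σ (ρ x) ≡ σ' x) →
             (Ms : Tms Θ Ξ) → substs σ (rens ρ Ms) ≡ substs σ' Ms
  sub-ren h (var x)    = h x
  sub-ren h unit       = refl
  sub-ren h (op c Ms)  = cong (op c) (subs-ren h Ms)
  sub-ren {σ = σ} {ρ} {σ'} h (lam M) = cong lam (sub-ren lifted M)
    where
      lifted : ∀ {A} (x : Var (B ∷ _) A) → liftSub σ (liftRen ρ x) ≡ liftSub σ' x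
      lifted vz     = refl
      lifted (vs x) = cong wk (h x)
  sub-ren h (app M N)  = cong₂ app (sub-ren h M) (sub-ren h N)
  sub-ren h (pair M N) = cong₂ pair (sub-ren h M) (sub-ren h N)
  sub-ren h (fst M)    = cong fst (sub-ren h M)
  sub-ren h (snd M)    = cong snd (sub-ren h M)
  subs-ren h []       = refl
  subs-ren h (M ∷ Ms) = cong₂ _∷_ (sub-ren h M) (subs-ren h Ms)

  ren-[/0] : (ρ : Ren Γ Δ) (M : Tm (A ∷ Δ) B) (N : Tm Δ A) →
             ren ρ (M [ N /0]) ≡ ren (liftRen ρ) M [ ren ρ N /0]
  ren-[/0] {Γ = Γ} {A = A} ρ M N = begin
    ren ρ (M [ N /0])                 ≡⟨ ren-sub agree₁ M ⟩
    subst extend M                    ≡⟨ sym (sub-ren agree₂ M) ⟩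
    ren (liftRen ρ) M [ ren ρ N /0]   ∎
    where
      open ≡-Reasoning
      -- the common substitution  (ρ N, ρ x₁, …, ρ xₙ)
      extend : Sub Γ (A ∷ _)
      extend vz     = ren ρ N
      extend (vs x) = var (ρ x)
      agree₁ : ∀ {B} (x : Var (A ∷ _) B) → _ ≡ extend x
      agree₁ vz     = refl
      agree₁ (vs x) = refl
      agree₂ : ∀ {B} (x : Var (A ∷ _) B) → _ ≡ extend x
      agree₂ vz     = refl
      agree₂ (vs x) = refl

  lookup-rens : (ρ : Ren Γ Δ) (Ms : Tms Δ Θ) (x : Var Θ A) →
                ren ρ (lookup Ms x) ≡ lookup (rens ρ Ms) x
  lookup-rens ρ (M ∷ Ms) vz     = refl
  lookup-rens ρ (M ∷ Ms) (vs x) = lookup-rens ρ Ms x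

  ren-≈ : (ρ : Ren Γ Δ) {M N : Tm Δ A} → M ≈ N → ren ρ M ≈ ren ρ N
  rens-≈ : (ρ : Ren Γ Δ) {Ms Ns : Tms Δ Θ} → Ms ≈s Ns → rens ρ Ms ≈s rens ρ Ns
  ren-≈ ρ ≈refl          = ≈refl
  ren-≈ ρ (≈sym e)       = ≈sym (ren-≈ ρ e)
  ren-≈ ρ (≈trans e e')  = ≈trans (ren-≈ ρ e) (ren-≈ ρ e')
  ren-≈ ρ (≈op c es)     = ≈op c (rens-≈ ρ es)
  ren-≈ ρ (≈lam e)       = ≈lam (ren-≈ (liftRen ρ) e)
  ren-≈ ρ (≈app e e')    = ≈app (ren-≈ ρ e) (ren-≈ ρ e')
  ren-≈ ρ (≈pair e e')   = ≈pair (ren-≈ ρ e) (ren-≈ ρ e')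
  ren-≈ ρ (≈fst e)       = ≈fst (ren-≈ ρ e)
  ren-≈ ρ (≈snd e)       = ≈snd (ren-≈ ρ e)
  ren-≈ ρ (β M N)        = subst₂ _≈_ refl (sym (ren-[/0] ρ M N)) (β _ _)
  ren-≈ ρ (η M)          = subst₂ _≈_ refl (cong (λ K → lam (app K (var vz))) (sym (wk-liftRen ρ M))) (η _)
  ren-≈ ρ (β₁ M N)       = β₁ _ _
  ren-≈ ρ (β₂ M N)       = β₂ _ _
  ren-≈ ρ (η⊗ M)         = η⊗ _
  ren-≈ ρ (η𝟙 M)         = η𝟙 _
  rens-≈ ρ []       = []
  rens-≈ ρ (e ∷ es) = ren-≈ ρ e ∷ rens-≈ ρ es

  -- One-step rewriting is stable under renaming; at the root this is the
  -- fact that renaming an instance L[M⃗] of a rule gives the instance L[ρM⃗].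
  ren-↦ : (ρ : Ren Γ Δ) {M N : Tm Δ A} → M ↦ N → ren ρ M ↦ ren ρ N
  rens-↦ : (ρ : Ren Γ Δ) {Ms Ns : Tms Δ Θ} → Ms ↦s Ns → rens ρ Ms ↦s rens ρ Ns
  ren-↦ ρ (root r Ms) =
    subst₂ _↦_ (sym (ren-sub (lookup-rens ρ Ms) (lhs r)))
               (sym (ren-sub (lookup-rens ρ Ms) (rhs r)))
               (root r (rens ρ Ms))
  ren-↦ ρ (s-op c s)   = s-op c (rens-↦ ρ s)
  ren-↦ ρ (s-lam s)    = s-lam (ren-↦ (liftRen ρ) s)
  ren-↦ ρ (s-appˡ s)   = s-appˡ (ren-↦ ρ s)
  ren-↦ ρ (s-appʳ s)   = s-appʳ (ren-↦ ρ s)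
  ren-↦ ρ (s-pairˡ s)  = s-pairˡ (ren-↦ ρ s)
  ren-↦ ρ (s-pairʳ s)  = s-pairʳ (ren-↦ ρ s)
  ren-↦ ρ (s-fst s)    = s-fst (ren-↦ ρ s)
  ren-↦ ρ (s-snd s)    = s-snd (ren-↦ ρ s)
  rens-↦ ρ (here s)  = here (ren-↦ ρ s)
  rens-↦ ρ (there s) = there (rens-↦ ρ s)

  map-⟶* : (f : Tm Γ A → Tm Γ' B) →
           (∀ {M N} → M ↦ N → f M ↦ f N) → (∀ {M N} → M ≈ N → f M ≈ f N) →
           {M N : Tm Γ A} → M ⟶* N → f M ⟶* f N
  map-⟶* f f-↦ f-≈ (conv e)    = conv (f-≈ e)
  map-⟶* f f-↦ f-≈ (step s)    = step (f-↦ s)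
  map-⟶* f f-↦ f-≈ (trans p q) = trans (map-⟶* f f-↦ f-≈ p) (map-⟶* f f-↦ f-≈ q)

  ren-⟶* : (ρ : Ren Γ Δ) {M N : Tm Δ A} → M ⟶* N → ren ρ M ⟶* ren ρ N
  ren-⟶* ρ = map-⟶* (ren ρ) (ren-↦ ρ) (ren-≈ ρ)

  data _⟶*s_ {Γ : C} : {Δ : C} → Tms Γ Δ → Tms Γ Δ → Set where
    []  : [] ⟶*s []
    _∷_ : {M N : Tm Γ A} {Ms Ns : Tms Γ Δ} → M ⟶* N → Ms ⟶*s Ns → (M ∷ Ms) ⟶*s (N ∷ Ns)

  ≈s-refl : (Ms : Tms Γ Δ) → Ms ≈s Ms
  ≈s-refl []       = []
  ≈s-refl (M ∷ Ms) = ≈refl ∷ ≈s-refl Ms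

  map-⟶*s : (g : Tms Γ Θ → Tm Γ' B) →
            (∀ {Ms Ns} → Ms ↦s Ns → g Ms ↦ g Ns) → (∀ {Ms Ns} → Ms ≈s Ns → g Ms ≈ g Ns) →
            {Ms Ns : Tms Γ Θ} → Ms ⟶*s Ns → g Ms ⟶* g Ns
  map-⟶*s g g-↦ g-≈ [] = conv ≈refl
  map-⟶*s g g-↦ g-≈ {M ∷ Ms} {N ∷ Ns} (p ∷ ps) =
    trans (map-⟶* (λ K → g (K ∷ Ms)) (λ s → g-↦ (here s)) (λ e → g-≈ (e ∷ ≈s-refl Ms)) p)
          (map-⟶*s (λ Ks → g (N ∷ Ks)) (λ s → g-↦ (there s)) (λ e → g-≈ (≈refl ∷ e)) ps)

  op-⟶* : (c : Op) {Ms Ns : Tms Γ (dom c)} → Ms ⟶*s Ns → op c Ms ⟶* op c Ns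
  op-⟶* c = map-⟶*s (op c) (s-op c) (≈op c)

  lam-⟶* : {M N : Tm (A ∷ Γ) B} → M ⟶* N → lam M ⟶* lam N
  lam-⟶* = map-⟶* lam s-lam ≈lam

  app-⟶* : {M M' : Tm Γ (A ⇒ B)} {N N' : Tm Γ A} → M ⟶* M' → N ⟶* N' → app M N ⟶* app M' N'
  app-⟶* {M' = M'} {N = N} p q =
    trans (map-⟶* (λ K → app K N) s-appˡ (λ e → ≈app e ≈refl) p)
          (map-⟶* (app M') s-appʳ (≈app ≈refl) q)

  pair-⟶* : {M M' : Tm Γ A} {N N' : Tm Γ B} → M ⟶* M' → N ⟶* N' → pair M N ⟶* pair M' N'
  pair-⟶* {M' = M'} {N = N} p q =
    trans (map-⟶* (λ K → pair K N) s-pairˡ (λ e → ≈pair e ≈refl) p)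
          (map-⟶* (pair M') s-pairʳ (≈pair ≈refl) q)

  fst-⟶* : {M N : Tm Γ (A ⊗ B)} → M ⟶* N → fst M ⟶* fst N
  fst-⟶* = map-⟶* fst s-fst ≈fst

  snd-⟶* : {M N : Tm Γ (A ⊗ B)} → M ⟶* N → snd M ⟶* snd N
  snd-⟶* = map-⟶* snd s-snd ≈snd

  -- Substitution is monotone: pointwise rewriting of the substituted terms
  -- rewrites the result.  This interprets the rewriting of the arguments
  -- of a rule application.
  subst-⟶* : {σ τ : Sub Γ Δ} → (∀ {A} (x : Var Δ A) → σ x ⟶* τ x) →
             (M : Tm Δ A) → subst σ M ⟶* subst τ M
  substs-⟶* : {σ τ : Sub Γ Δ} → (∀ {A} (x : Var Δ A) → σ x ⟶* τ x) →
              (Ms : Tms Δ Θ) → substs σ Ms ⟶*s substs τ Ms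
  subst-⟶* h (var x)    = h x
  subst-⟶* h unit       = conv ≈refl
  subst-⟶* h (op c Ms)  = op-⟶* c (substs-⟶* h Ms)
  subst-⟶* {σ = σ} {τ} h (lam M) = lam-⟶* (subst-⟶* lifted M)
    where
      lifted : ∀ {A} (x : Var (B ∷ _) A) → liftSub σ x ⟶* liftSub τ x
      lifted vz     = conv ≈refl
      lifted (vs x) = ren-⟶* vs (h x)
  subst-⟶* h (app M N)  = app-⟶* (subst-⟶* h M) (subst-⟶* h N)
  subst-⟶* h (pair M N) = pair-⟶* (subst-⟶* h M) (subst-⟶* h N)
  subst-⟶* h (fst M)    = fst-⟶* (subst-⟶* h M)
  subst-⟶* h (snd M)    = snd-⟶* (subst-⟶* h M)
  substs-⟶* h []       = []
  substs-⟶* h (M ∷ Ms) = subst-⟶* h M ∷ substs-⟶* h Ms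

  lookup-⟶* : {Ms Ns : Tms Γ Δ} → Ms ⟶*s Ns → (x : Var Δ A) → lookup Ms x ⟶* lookup Ns x
  lookup-⟶* (p ∷ ps) vz     = p
  lookup-⟶* (p ∷ ps) (vs x) = lookup-⟶* ps x

  rewriteOf : {P : Rd Γ A} {M N : Tm Γ A} → P ∶ M ⟶ N → M ⟶* N
  rewritesOf : {Ps : Rds Γ Δ} {Ms Ns : Tms Γ Δ} → Ps ∶s Ms ⟶ Ns → Ms ⟶*s Ns
  rewriteOf (t-var x)       = conv ≈refl
  rewriteOf t-unit          = conv ≈refl
  rewriteOf (t-op c ps)     = op-⟶* c (rewritesOf ps)
  rewriteOf (t-lam p)       = lam-⟶* (rewriteOf p)
  rewriteOf (t-app p q)     = app-⟶* (rewriteOf p) (rewriteOf q)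
  rewriteOf (t-pair p q)    = pair-⟶* (rewriteOf p) (rewriteOf q)
  rewriteOf (t-fst p)       = fst-⟶* (rewriteOf p)
  rewriteOf (t-snd p)       = snd-⟶* (rewriteOf p)
  rewriteOf (t-rule r {Ms = Ms} ps) =
    trans (step (root r Ms)) (subst-⟶* (lookup-⟶* (rewritesOf ps)) (rhs r))
  rewriteOf (t-seq p q)     = trans (rewriteOf p) (rewriteOf q)
  rewriteOf (t-conv p e e') = trans (conv (≈sym e)) (trans (rewriteOf p) (conv e'))
  rewritesOf []       = []
  rewritesOf (p ∷ ps) = rewriteOf p ∷ rewritesOf ps

  TypedRd : Tm Γ A → Tm Γ A → Set
  TypedRd M N = Σ (Rd _ _) λ P → P ∶ M ⟶ N

  TypedRds : Tms Γ Δ → Tms Γ Δ → Set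
  TypedRds Ms Ns = Σ (Rds _ _) λ Ps → Ps ∶s Ms ⟶ Ns

  -- Every one-step rewrite is realised by a reduction: the rule applied to
  -- identity reductions, placed in identity reductions of the context.
  reductionOf-↦ : {M N : Tm Γ A} → M ↦ N → TypedRd M N
  reductionsOf-↦ : {Ms Ns : Tms Γ Δ} → Ms ↦s Ns → TypedRds Ms Ns
  reductionOf-↦ (root r Ms) = rule r ⌜ Ms ⌝s , t-rule r (⌜⌝-typeds Ms)
  reductionOf-↦ (s-op c s) =
    let Ps , ps = reductionsOf-↦ s in op c Ps , t-op c ps
  reductionOf-↦ (s-lam s) =
    let P , p = reductionOf-↦ s in lam P , t-lam p
  reductionOf-↦ (s-appˡ {N = N} s) =
    let P , p = reductionOf-↦ s in app P ⌜ N ⌝ , t-app p (⌜⌝-typed N)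
  reductionOf-↦ (s-appʳ {M = M} s) =
    let P , p = reductionOf-↦ s in app ⌜ M ⌝ P , t-app (⌜⌝-typed M) p
  reductionOf-↦ (s-pairˡ {N = N} s) =
    let P , p = reductionOf-↦ s in pair P ⌜ N ⌝ , t-pair p (⌜⌝-typed N)
  reductionOf-↦ (s-pairʳ {M = M} s) =
    let P , p = reductionOf-↦ s in pair ⌜ M ⌝ P , t-pair (⌜⌝-typed M) p
  reductionOf-↦ (s-fst s) =
    let P , p = reductionOf-↦ s in fst P , t-fst p
  reductionOf-↦ (s-snd s) =
    let P , p = reductionOf-↦ s in snd P , t-snd p
  reductionsOf-↦ (here {Ms = Ms} s) =
    let P , p = reductionOf-↦ s in P ∷ ⌜ Ms ⌝s , p ∷ ⌜⌝-typeds Ms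
  reductionsOf-↦ (there {M = M} s) =
    let Ps , ps = reductionsOf-↦ s in ⌜ M ⌝ ∷ Ps , ⌜⌝-typed M ∷ ps

  -- Every rewrite sequence is realised by a reduction: conversions by
  -- identities (endpoints are taken modulo βη), sequences by composition.
  reductionOf : {M N : Tm Γ A} → M ⟶* N → TypedRd M N
  reductionOf {M = M} (conv e) = ⌜ M ⌝ , t-conv (⌜⌝-typed M) ≈refl e
  reductionOf (step s)         = reductionOf-↦ s
  reductionOf (trans {N = N} p q) =
    let P , p' = reductionOf p
        Q , q' = reductionOf q
    in seq P N Q , t-seq p' q'

  -- R(X) is locally thin, so all 2-functor laws hold trivially.
  functor : IdTwoFunctor
  functor = record
    { F₂       = λ c → rewriteOf (proj₂ c)
    ; F₂-resp  = λ _ → tt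
    ; F₂-id    = λ _ → tt
    ; F₂-vcomp = λ _ _ → tt
    }

  locallyFull : LocallyFull functor
  locallyFull s = reductionOf s , tt

theorem4p2 : (X : Sig2) → IsHRS X →
    Σ (Reductions.IdTwoFunctor X) (Reductions.LocallyFull X)
theorem4p2 X _ = FunctorToRewriting.functor X , FunctorToRewriting.locallyFull X
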